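{- For every $\pi \in S_n(132)$, $$\mathrm{rmax}(\pi) = \sum_{d=1}^{n}(-1)^{d+1}\,12\ldots d(\pi).$$
   Context: $S_n$ is the set of permutations of $\{1,\dots,n\}$ in one-line notation, and $S_n(132)$ the set of those with no subsequence $\pi(i)\pi(j)\pi(k)$, $i<j<k$, satisfying $\pi(i)<\pi(k)<\pi(j)$. $\mathrm{rmax}(\pi)$ is the number of right-to-left maxima of $\pi$, i.e. the number of positions $i$ such that $\pi(i)>\pi(j)$ for all $j>i$. For $d\ge1$, $12\ldots d(\pi)$ is the number of increasing subsequences of length $d$ in $\pi$. -}

module Defs where

open import Data.Nat using (ℕ; zero; suc)
open import Data.Fin using (Fin; toℕ) renaming (_<_ to _<ᶠ_)
open import Data.Fin.Properties using (_<?_)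
open import Data.Integer using (ℤ; +_; -_; _+_)
open import Data.List using (List; []; _∷_; map; filter; length; allFin; concatMap; sum)
open import Data.List.Relation.Unary.All using (All; all?)
open import Data.List.Relation.Unary.Linked using (Linked; linked?)
open import Data.Product using (_×_)
open import Function.Definitions using (Injective)
open import Relation.Binary.PropositionalEquality using (_≡_)
open import Relation.Nullary using (¬_)

-- A permutation of {1..n} in one-line notation: an injective map Fin n → Fin n
-- (positions 0..n-1 to values 0..n-1; injective endomaps of a finite set are bijections).
IsPerm : {n : ℕ} → (Fin n → Fin n) → Set
IsPerm π = Injective _≡_ _≡_ π

Avoids132 : {n : ℕ} → (Fin n → Fin n) → Set
Avoids132 {n} π = (i j k : Fin n) → i <ᶠ j → j <ᶠ k → ¬ (π i <ᶠ π k × π k <ᶠ π j)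

tuples : (n d : ℕ) → List (List (Fin n))
tuples n zero = [] ∷ []
tuples n (suc d) = concatMap (λ i → map (i ∷_) (tuples n d)) (allFin n)

rmax : {n : ℕ} → (Fin n → Fin n) → ℕ
rmax {n} π = length (filter (λ i → all? (λ j → π j <? π i) (filter (λ j → i <? j) (allFin n))) (allFin n))

incSeq : {n : ℕ} → (Fin n → Fin n) → ℕ → ℕ
incSeq {n} π d = length (filter (λ is → linked? (λ a b → a <? b) is)
                   (filter (λ is → linked? (λ a b → π a <? π b) is) (tuples n d)))

signed : ℕ → ℕ → ℤ
signed zero x = - (+ x)
signed (suc zero) x = + x
signed (suc (suc d)) x = signed d x

altSum : (ℕ → ℕ) → ℕ → ℤ
altSum f zero = + 0
altSum f (suc m) = altSum f m + signed (suc m) (f (suc m))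

{-# OPTIONS --safe #-}
module Submission where

-- For a position i let c i d be the number of increasing subsequences of length d + 1 starting
-- at i, so that 12…(d+1)(π) = Σᵢ c i d and it suffices to show that Σ_{d ≥ 1} (-1)^{d+1} c i (d - 1)
-- is 1 if i is a right-to-left maximum and 0 otherwise. In the first case c i d = 0 for d > 0.
-- Otherwise let k be the leftmost position right of i with π k > π i. Avoiding 132 forces every
-- other such position to lie right of k with a value above π k, so c i (d + 1) = c k d + c k (d + 1)
-- and the alternating sum telescopes to ± c k (n - 1), which is 0 because k > 0.

open import Defs
open import Data.Nat using (ℕ)
open import Data.Fin using (Fin)
open import Data.Integer using (+_)
open import Relation.Binary.PropositionalEquality using (_≡_)

open import Algebra.Properties.CommutativeSemigroup using (interchange)
open import Data.Bool.Base using (true; false; if_then_else_)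
open import Data.Fin.Base as Fin using (toℕ; fromℕ<) renaming (_<_ to _<ᶠ_; _≤_ to _≤ᶠ_)
open import Data.Fin.Properties
  using ( _≟_; _<?_; toℕ<n; toℕ-injective; toℕ-inject; toℕ-fromℕ<; nonZeroIndex; ¬∀⟶∃¬-smallest
        ; <-cmp; <-trans; <-irrefl; ≤∧≢⇒<)
import Data.Integer as ℤ
import Data.Integer.Properties as ℤ
open import Data.Integer.Solver using (module +-*-Solver)
open import Data.List.Base using (List; []; _∷_; _++_; map; filter; length; tabulate; concatMap; allFin)
open import Data.List.Properties using (length-++; filter-++; filter-≐; filter-none)
open import Data.List.Relation.Unary.All as All using (All; all?)
open import Data.List.Relation.Unary.Linked as Linked using (linked?; _∷_)
open import Data.List.Membership.Propositional.Properties using (∈-filter⁺; ∈-filter⁻; ∈-allFin)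
open import Data.Nat.Base using (zero; suc; pred; _+_; _≤_; z≤n; s≤s; NonZero)
open import Data.Nat.Properties
  using ( +-0-commutativeMonoid; +-identityʳ; +-suc; +-monoˡ-≤; ≤-trans; ≤-reflexive; suc-pred
        ; ≤⇒≯; <-asym; ≮⇒≥)
open import Data.Product using (_×_; _,_; proj₂; ∃-syntax)
open import Data.Sum using (_⊎_; inj₁; inj₂; fromInj₂)
open import Function.Base using (_∘_)
open import Function.Bundles using (_⇔_; mk⇔; Equivalence)
open import Level using (Level)
open import Relation.Binary.Core using (Rel)
import Relation.Binary.Definitions as B
open import Relation.Binary.Construct.Intersection using () renaming (_∩_ to _∩ᵇ_)
open import Relation.Binary.PropositionalEquality
  using (_≗_; refl; sym; trans; cong; cong₂; subst; module ≡-Reasoning)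
open import Relation.Nullary using (¬_; yes; no; does; _×-dec_; ¬?; contradiction)
open import Relation.Nullary.Decidable using (does-⇔; dec-true; dec-false; decidable-stable)
open import Relation.Unary using (Pred; Decidable; ∁)
open import Relation.Unary.Properties using (_∩?_)

open import Algebra.Properties.CommutativeMonoid.Sum +-0-commutativeMonoid
  using (sum-syntax; sum-cong-≗; sum-replicate-zero; ∑-distrib-+)

open Equivalence using (to; from)

private
  variable
    a b p q : Level
    A : Set a
    B : Set b

module _ {P : Pred A p} (P? : Decidable P) where

  length-filter-++ : ∀ xs ys →
    length (filter P? (xs ++ ys)) ≡ length (filter P? xs) + length (filter P? ys)
  length-filter-++ xs ys = trans (cong length (filter-++ P? xs ys)) (length-++ (filter P? xs))

  length-filter-map : (g : B → A) → ∀ xs → length (filter P? (map g xs)) ≡ length (filter (P? ∘ g) xs)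
  length-filter-map g [] = refl
  length-filter-map g (x ∷ xs) with does (P? (g x))
  ... | true = cong suc (length-filter-map g xs)
  ... | false = length-filter-map g xs

  length-filter-tabulate : ∀ {n} (g : Fin n → A) →
    length (filter P? (tabulate g)) ≡ ∑[ i < n ] (if does (P? (g i)) then 1 else 0)
  length-filter-tabulate {n = zero} g = refl
  length-filter-tabulate {n = suc n} g with does (P? (g Fin.zero))
  ... | true = cong suc (length-filter-tabulate (g ∘ Fin.suc))
  ... | false = length-filter-tabulate (g ∘ Fin.suc)

  length-filter-concatMap-tabulate : ∀ {n} (f : B → List A) (g : Fin n → B) →
    length (filter P? (concatMap f (tabulate g))) ≡ ∑[ i < n ] length (filter P? (f (g i)))
  length-filter-concatMap-tabulate {n = zero} f g = refl
  length-filter-concatMap-tabulate {n = suc n} f g =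
    trans (length-filter-++ (f (g Fin.zero)) _)
          (cong₂ _+_ refl (length-filter-concatMap-tabulate f (g ∘ Fin.suc)))

filter-filter : {P : Pred A p} {Q : Pred A q} (P? : Decidable P) (Q? : Decidable Q) →
  filter P? ∘ filter Q? ≗ filter (Q? ∩? P?)
filter-filter P? Q? [] = refl
filter-filter P? Q? (x ∷ xs) with does (Q? x)
... | false = filter-filter P? Q? xs
... | true with does (P? x)
...   | true = cong (x ∷_) (filter-filter P? Q? xs)
...   | false = filter-filter P? Q? xs

length-filter-tuples-suc : ∀ {n} {P : Pred (List (Fin n)) p} (P? : Decidable P) d →
  length (filter P? (tuples n (suc d))) ≡ ∑[ i < n ] length (filter (λ t → P? (i ∷ t)) (tuples n d))
length-filter-tuples-suc {n = n} P? d =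
  trans (length-filter-concatMap-tabulate P? (λ i → map (i ∷_) (tuples n d)) (λ i → i))
        (sum-cong-≗ (λ i → length-filter-map P? (i ∷_) (tuples n d)))

∑-δ : ∀ {n} (k : Fin n) (c : Fin n → ℕ) → ∑[ j < n ] (if does (j ≟ k) then c j else 0) ≡ c k
∑-δ {suc n} Fin.zero c = trans (cong₂ _+_ refl (sum-replicate-zero n)) (+-identityʳ (c Fin.zero))
∑-δ {suc n} (Fin.suc k) c = ∑-δ k (c ∘ Fin.suc)

¬∀¬⟶∃-smallest : ∀ {n} {P : Pred (Fin n) p} → Decidable P → ¬ (∀ j → ¬ P j) →
  ∃[ k ] P k × (∀ j → P j → k ≤ᶠ j)
¬∀¬⟶∃-smallest {n = n} {P = P} P? ¬∀¬P with ¬∀⟶∃¬-smallest n (∁ P) (¬? ∘ P?) ¬∀¬P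
... | k , ¬¬Pk , before = k , decidable-stable (P? k) ¬¬Pk , smallest
  where
  smallest : ∀ j → P j → k ≤ᶠ j
  smallest j Pj = ≮⇒≥ λ j<k → before (fromℕ< j<k) (subst P (sym (inject-fromℕ< j<k)) Pj)
    where
    inject-fromℕ< : ∀ {j} (j<k : j <ᶠ k) → Fin.inject (fromℕ< j<k) ≡ j
    inject-fromℕ< j<k = toℕ-injective (trans (toℕ-inject (fromℕ< j<k)) (toℕ-fromℕ< j<k))

signed-+ : ∀ k m n → signed k (m + n) ≡ signed k m ℤ.+ signed k n
signed-+ zero m n = trans (cong ℤ.-_ (ℤ.pos-+ m n)) (ℤ.neg-distrib-+ (+ m) (+ n))
signed-+ (suc zero) m n = ℤ.pos-+ m n
signed-+ (suc (suc k)) m n = signed-+ k m n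

signed-0 : ∀ k → signed k 0 ≡ + 0
signed-0 zero = refl
signed-0 (suc zero) = refl
signed-0 (suc (suc k)) = signed-0 k

signed-suc : ∀ k m → signed (suc k) m ≡ ℤ.- signed k m
signed-suc zero m = sym (ℤ.neg-involutive (+ m))
signed-suc (suc zero) m = refl
signed-suc (suc (suc k)) m = signed-suc k m

altSum-cong : ∀ {f g} → (∀ d → f (suc d) ≡ g (suc d)) → ∀ m → altSum f m ≡ altSum g m
altSum-cong f≗g zero = refl
altSum-cong f≗g (suc m) = cong₂ ℤ._+_ (altSum-cong f≗g m) (cong (signed (suc m)) (f≗g m))

altSum-zero : ∀ m → altSum (λ _ → 0) m ≡ + 0
altSum-zero zero = refl
altSum-zero (suc m) = cong₂ ℤ._+_ (altSum-zero m) (signed-0 (suc m))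

altSum-+ : ∀ f g m → altSum (λ d → f d + g d) m ≡ altSum f m ℤ.+ altSum g m
altSum-+ f g zero = refl
altSum-+ f g (suc m) =
  trans (cong₂ ℤ._+_ (altSum-+ f g m) (signed-+ (suc m) (f (suc m)) (g (suc m))))
        (interchange ℤ.+-commutativeSemigroup (altSum f m) (altSum g m)
          (signed (suc m) (f (suc m))) (signed (suc m) (g (suc m))))

altSum-∑ : ∀ {n} (H : Fin n → ℕ → ℕ) (c : Fin n → ℕ) m → (∀ i → altSum (H i) m ≡ + c i) →
  altSum (λ d → ∑[ i < n ] H i d) m ≡ + ∑[ i < n ] c i
altSum-∑ {zero} H c m _ = altSum-zero m
altSum-∑ {suc n} H c m eq =
  trans (altSum-+ (H Fin.zero) (λ d → ∑[ i < n ] H (Fin.suc i) d) m)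
        (trans (cong₂ ℤ._+_ (eq Fin.zero) (altSum-∑ (H ∘ Fin.suc) (c ∘ Fin.suc) m (eq ∘ Fin.suc)))
               (sym (ℤ.pos-+ (c Fin.zero) (∑[ i < n ] c (Fin.suc i)))))

altSum-telescope : (A B : ℕ → ℕ) → (∀ d → A (suc d) ≡ B d + B (suc d)) → ∀ m →
  altSum (λ d → A (pred d)) (suc m) ≡ + A 0 ℤ.- + B 0 ℤ.+ signed (suc m) (B m)
altSum-telescope A B split zero = solve 2 (λ a b → a := a :- b :+ b) refl (+ A 0) (+ B 0)
  where open +-*-Solver
altSum-telescope A B split (suc m) = begin
    altSum (λ d → A (pred d)) (suc m) ℤ.+ signed (suc (suc m)) (A (suc m))
  ≡⟨ cong₂ ℤ._+_ (altSum-telescope A B split m)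
                 (trans (cong (signed (suc (suc m))) (split m)) (signed-+ (suc (suc m)) (B m) (B (suc m)))) ⟩
    + A 0 ℤ.- + B 0 ℤ.+ s ℤ.+ (signed (suc (suc m)) (B m) ℤ.+ t)
  ≡⟨ cong (λ x → + A 0 ℤ.- + B 0 ℤ.+ s ℤ.+ (x ℤ.+ t)) (signed-suc (suc m) (B m)) ⟩
    + A 0 ℤ.- + B 0 ℤ.+ s ℤ.+ (ℤ.- s ℤ.+ t)
  ≡⟨ solve 4 (λ a b s t → a :- b :+ s :+ (:- s :+ t) := a :- b :+ t) refl (+ A 0) (+ B 0) s t ⟩
    + A 0 ℤ.- + B 0 ℤ.+ t
  ∎
  where
  open ≡-Reasoning
  open +-*-Solver
  s t : ℤ.ℤ
  s = signed (suc m) (B m)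
  t = signed (suc (suc m)) (B (suc m))

module Chains {n r} {R : Rel (Fin n) r} (R? : B.Decidable R) where

  chainsFrom : Fin n → ℕ → ℕ
  chainsFrom i d = length (filter (λ t → linked? R? (i ∷ t)) (tuples n d))

  chainsFrom-suc : ∀ i d →
    chainsFrom i (suc d) ≡ ∑[ j < n ] (if does (R? i j) then chainsFrom j d else 0)
  chainsFrom-suc i d = trans (length-filter-tuples-suc (λ t → linked? R? (i ∷ t)) d) (sum-cong-≗ extend)
    where
    extend : ∀ j → length (filter (λ t → linked? R? (i ∷ j ∷ t)) (tuples n d))
                 ≡ (if does (R? i j) then chainsFrom j d else 0)
    extend j with R? i j
    ... | yes Rij = cong length (filter-≐ _ _ (Linked.tail , Rij ∷_) (tuples n d))
    ... | no ¬Rij = cong length (filter-none _ (All.universal (λ t → ¬Rij ∘ Linked.head) (tuples n d)))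

  chainsFrom-maximal : ∀ i → (∀ j → ¬ R i j) → ∀ d → chainsFrom i (suc d) ≡ 0
  chainsFrom-maximal i maximal d = trans (chainsFrom-suc i d) (trans (sum-cong-≗ none) (sum-replicate-zero n))
    where
    none : ∀ j → (if does (R? i j) then chainsFrom j d else 0) ≡ 0
    none j = cong (λ b → if b then chainsFrom j d else 0) (dec-false (R? i j) (maximal j))

  chainsFrom-split : ∀ i k → ¬ R k k → (∀ j → R i j ⇔ (j ≡ k ⊎ R k j)) →
    ∀ d → chainsFrom i (suc d) ≡ chainsFrom k d + chainsFrom k (suc d)
  chainsFrom-split i k ¬Rkk split d = begin
      chainsFrom i (suc d)                          ≡⟨ chainsFrom-suc i d ⟩
      ∑[ j < n ] (if does (R? i j) then c j else 0) ≡⟨ sum-cong-≗ separate ⟩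
      ∑[ j < n ] (atK j + afterK j)                 ≡⟨ ∑-distrib-+ atK afterK ⟩
      ∑[ j < n ] atK j + ∑[ j < n ] afterK j        ≡⟨ cong₂ _+_ (∑-δ k c) (sym (chainsFrom-suc k d)) ⟩
      chainsFrom k d + chainsFrom k (suc d)         ∎
    where
    open ≡-Reasoning
    c atK afterK : Fin n → ℕ
    c j = chainsFrom j d
    atK j = if does (j ≟ k) then c j else 0
    afterK j = if does (R? k j) then c j else 0
    separate : ∀ j → (if does (R? i j) then c j else 0)
                   ≡ (if does (j ≟ k) then c j else 0) + (if does (R? k j) then c j else 0)
    separate j with j ≟ k
    ... | yes refl rewrite dec-true (R? i k) (from (split k) (inj₁ refl)) | dec-false (R? k k) ¬Rkk =
      sym (+-identityʳ (c k))
    ... | no j≢k = cong (λ b → if b then c j else 0) (does-⇔ Rij⇔Rkj (R? i j) (R? k j))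
      where
      Rij⇔Rkj : R i j ⇔ R k j
      Rij⇔Rkj = mk⇔ (fromInj₂ (λ j≡k → contradiction j≡k j≢k) ∘ to (split j))
                    (from (split j) ∘ inj₂)

  chainsFrom-vanish : (∀ {i j} → R i j → i <ᶠ j) → ∀ i d → n ≤ toℕ i + d → chainsFrom i d ≡ 0
  chainsFrom-vanish R⇒< i zero n≤i+0 =
    contradiction (toℕ<n i) (≤⇒≯ (≤-trans n≤i+0 (≤-reflexive (+-identityʳ (toℕ i)))))
  chainsFrom-vanish R⇒< i (suc d) n≤i+1+d =
    trans (chainsFrom-suc i d) (trans (sum-cong-≗ vanish) (sum-replicate-zero n))
    where
    vanish : ∀ j → (if does (R? i j) then chainsFrom j d else 0) ≡ 0
    vanish j with R? i j
    ... | yes Rij = chainsFrom-vanish R⇒< j d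
      (≤-trans n≤i+1+d (≤-trans (≤-reflexive (+-suc (toℕ i) d)) (+-monoˡ-≤ d (R⇒< Rij))))
    ... | no _ = refl

  altSum-chainsFrom-maximal : ∀ i → (∀ j → ¬ R i j) → altSum (λ d → chainsFrom i (pred d)) n ≡ + 1
  altSum-chainsFrom-maximal i maximal = begin
      altSum (λ d → chainsFrom i (pred d)) n
    ≡⟨ cong (altSum _) (sym (suc-pred n)) ⟩
      altSum (λ d → chainsFrom i (pred d)) (suc (pred n))
    ≡⟨ altSum-telescope (chainsFrom i) (λ _ → 0) (chainsFrom-maximal i maximal) (pred n) ⟩
      + 1 ℤ.- + 0 ℤ.+ signed (suc (pred n)) 0
    ≡⟨ cong (λ x → + 1 ℤ.+ x) (signed-0 (suc (pred n))) ⟩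
      + 1
    ∎
    where
    open ≡-Reasoning
    instance
      n≢0 : NonZero n
      n≢0 = nonZeroIndex i

  altSum-chainsFrom-split : (∀ {i j} → R i j → i <ᶠ j) → ∀ i k →
    (∀ j → R i j ⇔ (j ≡ k ⊎ R k j)) → altSum (λ d → chainsFrom i (pred d)) n ≡ + 0
  altSum-chainsFrom-split R⇒< i k split = begin
      -- chainsFrom i 0 and chainsFrom k 0 both compute to 1.
      altSum (λ d → chainsFrom i (pred d)) n
    ≡⟨ cong (altSum _) (sym (suc-pred n)) ⟩
      altSum (λ d → chainsFrom i (pred d)) (suc (pred n))
    ≡⟨ altSum-telescope (chainsFrom i) (chainsFrom k) (chainsFrom-split i k ¬Rkk split) (pred n) ⟩
      + 1 ℤ.- + 1 ℤ.+ signed (suc (pred n)) (chainsFrom k (pred n))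
    ≡⟨ cong (λ x → + 0 ℤ.+ signed (suc (pred n)) x) (chainsFrom-vanish R⇒< k (pred n) n≤k+n-1) ⟩
      + 0 ℤ.+ signed (suc (pred n)) 0
    ≡⟨ cong (λ x → + 0 ℤ.+ x) (signed-0 (suc (pred n))) ⟩
      + 0
    ∎
    where
    open ≡-Reasoning
    instance
      n≢0 : NonZero n
      n≢0 = nonZeroIndex i
    ¬Rkk : ¬ R k k
    ¬Rkk = <-irrefl refl ∘ R⇒<
    n≤k+n-1 : n ≤ toℕ k + pred n
    n≤k+n-1 = ≤-trans (≤-reflexive (sym (suc-pred n)))
                      (+-monoˡ-≤ (pred n) (≤-trans (s≤s z≤n) (R⇒< (from (split k) (inj₁ refl)))))

module _ {n} (π : Fin n → Fin n) where

  Noninversion : Rel (Fin n) _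
  Noninversion = (λ i j → π i <ᶠ π j) ∩ᵇ _<ᶠ_

  noninversion? : B.Decidable Noninversion
  noninversion? i j = π i <? π j ×-dec i <? j

  open Chains noninversion?

  IsRmax : Fin n → Set
  IsRmax i = All (λ j → π j <ᶠ π i) (filter (i <?_) (allFin n))

  isRmax? : Decidable IsRmax
  isRmax? i = all? (λ j → π j <? π i) (filter (i <?_) (allFin n))

  isRmax⇒maximal : ∀ {i} → IsRmax i → ∀ j → ¬ Noninversion i j
  isRmax⇒maximal rm j (πi<πj , i<j) = <-asym πi<πj (All.lookup rm (∈-filter⁺ (_ <?_) (∈-allFin j) i<j))

  maximal⇒isRmax : IsPerm π → ∀ {i} → (∀ j → ¬ Noninversion i j) → IsRmax i
  maximal⇒isRmax inj {i} maximal =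
    All.tabulate (λ {j} j∈ → below j (proj₂ (∈-filter⁻ (i <?_) {xs = allFin n} j∈)))
    where
    below : ∀ j → i <ᶠ j → π j <ᶠ π i
    below j i<j with <-cmp (π j) (π i)
    ... | B.tri< πj<πi _ _ = πj<πi
    ... | B.tri≈ _ πj≡πi _ = contradiction (inj πj≡πi) (λ j≡i → <-irrefl (sym j≡i) i<j)
    ... | B.tri> _ _ πi<πj = contradiction (πi<πj , i<j) (maximal j)

  leftmost-noninversion-splits : IsPerm π → Avoids132 π → ∀ {i k} → Noninversion i k →
    (∀ j → Noninversion i j → k ≤ᶠ j) → ∀ j → Noninversion i j ⇔ (j ≡ k ⊎ Noninversion k j)
  leftmost-noninversion-splits inj avoids {i} {k} (πi<πk , i<k) leftmost j = mk⇔ split merge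
    where
    split : Noninversion i j → j ≡ k ⊎ Noninversion k j
    split (πi<πj , i<j) with j ≟ k
    ... | yes j≡k = inj₁ j≡k
    ... | no j≢k = inj₂ (πk<πj , k<j)
      where
      k<j : k <ᶠ j
      k<j = ≤∧≢⇒< (leftmost j (πi<πj , i<j)) (j≢k ∘ sym)
      πk<πj : π k <ᶠ π j
      πk<πj = ≤∧≢⇒< (≮⇒≥ λ πj<πk → avoids i k j i<k k<j (πi<πj , πj<πk))
                    (j≢k ∘ sym ∘ inj)
    merge : j ≡ k ⊎ Noninversion k j → Noninversion i j
    merge (inj₁ refl) = πi<πk , i<k
    merge (inj₂ (πk<πj , k<j)) = <-trans πi<πk πk<πj , <-trans i<k k<j

  altSum-chainsFrom : IsPerm π → Avoids132 π → ∀ i →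
    altSum (λ d → chainsFrom i (pred d)) n ≡ + (if does (isRmax? i) then 1 else 0)
  altSum-chainsFrom inj avoids i with isRmax? i
  ... | yes rm = altSum-chainsFrom-maximal i (isRmax⇒maximal rm)
  ... | no ¬rm with ¬∀¬⟶∃-smallest (noninversion? i) (¬rm ∘ maximal⇒isRmax inj)
  ...   | k , noninv , leftmost =
    altSum-chainsFrom-split proj₂ i k (leftmost-noninversion-splits inj avoids noninv leftmost)

  incSeq-suc : ∀ d → incSeq π (suc d) ≡ ∑[ i < n ] chainsFrom i d
  incSeq-suc d = begin
      incSeq π (suc d)
    ≡⟨ cong length (filter-filter (linked? (λ i j → i <? j)) (linked? (λ i j → π i <? π j)) ts) ⟩
      length (filter (linked? (λ i j → π i <? π j) ∩? linked? (λ i j → i <? j)) ts)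
    ≡⟨ cong length (filter-≐ _ (linked? noninversion?) (Linked.zip , Linked.unzip) ts) ⟩
      length (filter (linked? noninversion?) ts)
    ≡⟨ length-filter-tuples-suc (linked? noninversion?) d ⟩
      ∑[ i < n ] chainsFrom i d
    ∎
    where
    open ≡-Reasoning
    ts : List (List (Fin n))
    ts = tuples n (suc d)

mainTheorem13 : (n : ℕ) (π : Fin n → Fin n) → IsPerm π → Avoids132 π →
    + rmax π ≡ altSum (incSeq π) n
mainTheorem13 n π inj avoids = begin
    + rmax π
  ≡⟨ cong +_ (length-filter-tabulate (isRmax? π) (λ i → i)) ⟩
    + ∑[ i < n ] (if does (isRmax? π i) then 1 else 0)
  ≡⟨ altSum-∑ (λ i d → chainsFrom i (pred d)) _ n (altSum-chainsFrom π inj avoids) ⟨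
    altSum (λ d → ∑[ i < n ] chainsFrom i (pred d)) n
  ≡⟨ altSum-cong (λ d → sym (incSeq-suc π d)) n ⟩
    altSum (incSeq π) n
  ∎
  where
  open ≡-Reasoning
  open Chains (noninversion? π)
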